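{- Let $n=p_1^{n_1}\cdots p_r^{n_r}$ with primes $p_1<\cdots<p_r$ and positive integers $n_i$. Let $a,b\in[r]$ with $a\neq b$, $s\in[n_a]$, and let $Q_{a,b}^s$ be the union of the subgroups $S_{n/(p_ip_a^s)}$ of $C_n$, $i\in[r]\setminus\{a,b\}$. Then $$|Q_{a,b}^s|=\frac{n}{p_1\cdots p_r}\cdot\frac{p_b}{p_a^{s-1}}\cdot\left[\frac{p_1\cdots p_r}{p_ap_b}-\phi\!\left(\frac{p_1\cdots p_r}{p_ap_b}\right)\right].$$
   Context: $\phi$ is Euler's totient function; $C_n$ is the cyclic group of order $n$; $S_d$ is the unique subgroup of $C_n$ of order $d$; $[m]=\{1,\dots,m\}$. -}

module Defs where

open import Data.Nat using (ℕ; zero; suc; _+_; _*_; _^_; _∸_)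
open import Data.Nat.DivMod using (_/_)
open import Data.Nat.Divisibility using (_∣_; _∣?_)
open import Data.Nat.GCD using (gcd)
open import Data.Fin using (Fin; toℕ)
open import Data.Fin.Properties using (any?)
open import Data.List using (List; length; filter; map; upTo)
open import Data.Nat.ListAction using (product)
open import Data.List.Base using (allFin)
open import Data.Product using (∃-syntax; _×_)
open import Relation.Nullary using (¬_; Dec; yes; no)
open import Relation.Nullary.Decidable using (_×-dec_; ¬?)
open import Relation.Unary using (Pred; Decidable)
open import Relation.Binary.PropositionalEquality using (_≡_)
import Data.Fin.Properties as FinP
import Data.Nat.Properties as NatP

-- Total natural-number division (m // 0 = 0); used only with exact, nonzero divisors.
_//_ : ℕ → ℕ → ℕ
m // zero = 0
m // suc k = m / suc k

card : ∀ {n} (P : Fin n → Set) → Decidable P → ℕ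
card {n} P P? = length (filter P? (allFin n))

φ : ℕ → ℕ
φ m = length (filter (λ k → gcd k m NatP.≟ 1) (map suc (upTo m)))

∏ : ∀ {r} → (Fin r → ℕ) → ℕ
∏ {r} f = product (map f (allFin r))

-- C_n is modelled as ℤ/nℤ with carrier Fin n (residues 0..n-1, identified via toℕ).
-- S n d : the subgroup of C_n of order d (d ∣ n), i.e. the elements x with d·x = 0 in C_n.
S : (n d : ℕ) → Pred (Fin n) _
S n d x = n ∣ d * toℕ x

S? : (n d : ℕ) → Decidable (S n d)
S? n d x = n ∣? (d * toℕ x)

nOf : ∀ {r} → (Fin r → ℕ) → (Fin r → ℕ) → ℕ
nOf p e = ∏ (λ i → p i ^ e i)

Q : ∀ {r} (p e : Fin r → ℕ) (a b : Fin r) (s : ℕ) → Pred (Fin (nOf p e)) _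
Q {r} p e a b s x =
  ∃[ i ] (¬ (i ≡ a) × ¬ (i ≡ b) × S (nOf p e) (nOf p e // (p i * p a ^ s)) x)

Q? : ∀ {r} (p e : Fin r → ℕ) (a b : Fin r) (s : ℕ) → Decidable (Q p e a b s)
Q? {r} p e a b s x =
  any? (λ i → ¬? (i FinP.≟ a) ×-dec (¬? (i FinP.≟ b) ×-dec
               S? (nOf p e) (nOf p e // (p i * p a ^ s)) x))

-- Writing D = p_a^s and M = ∏_{i ∉ {a,b}} p_i, we have M·D ∣ n, and the subgroup of C_n of order
-- n/(p_i D) consists of the multiples of p_i D. So Q is the set of multiples y·D with y < n/D such
-- that some p_i (i ∉ {a,b}) divides y. This condition is periodic mod M, so it holds for
-- (n/(MD))·#{y < M : gcd(y,M) ≠ 1} = (n/(MD))·(M − φ(M)) elements; multiplying by p_a^(s-1)·P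
-- with P = p_a p_b M gives the claim.
module Submission where

open import Data.Fin using (Fin; zero; suc; toℕ)
import Data.Fin as F
open import Data.Fin.Properties using (any?; _≟_)
open import Data.List using ([]; _∷_; length; filter; map; applyUpTo; upTo; tabulate; allFin)
open import Data.List.Properties using (map-tabulate)
open import Data.Nat using (ℕ; zero; suc; _+_; _*_; _^_; _∸_; _≤_; _<_; NonZero; z<s; s<s)
open import Data.Nat.Coprimality using (Coprime; coprime-divisor; coprime⇒gcd≡1)
open import Data.Nat.DivMod using (_/_; m*n/n≡m)
open import Data.Nat.Divisibility
open import Data.Nat.GCD using (gcd; gcd-greatest)
open import Data.Nat.ListAction using (product)
open import Data.Nat.Primality using (Prime; prime⇒irreducible; prime⇒nonZero; ¬prime[1])
open import Data.Nat.Properties renaming (_≟_ to _≟ℕ_)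
open import Algebra.Properties.CommutativeSemigroup *-commutativeSemigroup
  using (x∙yz≈y∙xz; x∙yz≈z∙xy)
open import Data.Nat.Tactic.RingSolver using (solve-∀)
open import Data.Product using (∃-syntax; _×_; _,_; proj₁; proj₂)
open import Data.Sum using (inj₁; inj₂)
open import Data.Vec.Functional using (updateAt)
open import Data.Vec.Functional.Properties using (updateAt-updates; updateAt-minimal)
open import Function using (_∘_; id; const)
open import Level using (Level)
open import Relation.Binary.PropositionalEquality
open import Relation.Nullary using (Dec; yes; no; ¬_; ¬?; contradiction)
open import Relation.Nullary.Decidable using (_×-dec_)
open import Relation.Unary using (Pred; Decidable; _≐_; ∁)
open import Defs

private variable
  ℓ ℓ′ : Level
  r : ℕ
  P : Pred ℕ ℓ
  R : Pred ℕ ℓ′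

indicator : ∀ {A : Set ℓ} → Dec A → ℕ
indicator (yes _) = 1
indicator (no _) = 0

indicator-cong : ∀ {A : Set ℓ} {B : Set ℓ′} (A? : Dec A) (B? : Dec B) →
                 (A → B) → (B → A) → indicator A? ≡ indicator B?
indicator-cong (yes _) (yes _) _ _ = refl
indicator-cong (yes a) (no ¬b) f _ = contradiction (f a) ¬b
indicator-cong (no ¬a) (yes b) _ g = contradiction (g b) ¬a
indicator-cong (no _) (no _) _ _ = refl

count : {P : Pred ℕ ℓ} → Decidable P → ℕ → ℕ
count P? zero = 0
count P? (suc n) = indicator (P? 0) + count (P? ∘ suc) n

count-+ : ∀ (P? : Decidable P) m n → count P? (m + n) ≡ count P? m + count (P? ∘ (m +_)) n
count-+ P? zero n = refl
count-+ P? (suc m) n =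
  trans (cong (indicator (P? 0) +_) (count-+ (P? ∘ suc) m n)) (sym (+-assoc (indicator (P? 0)) _ _))

count-cong : (P? : Decidable P) (R? : Decidable R) → P ≐ R → ∀ n → count P? n ≡ count R? n
count-cong P? R? P≐R zero = refl
count-cong P? R? (P⊆R , R⊆P) (suc n) =
  cong₂ _+_ (indicator-cong (P? 0) (R? 0) P⊆R R⊆P)
            (count-cong (P? ∘ suc) (R? ∘ suc) (P⊆R , R⊆P) n)

count-none : ∀ (P? : Decidable P) n → (∀ y → y < n → ¬ P y) → count P? n ≡ 0
count-none P? zero _ = refl
count-none P? (suc n) none with P? 0
... | yes p0 = contradiction p0 (none 0 z<s)
... | no _ = count-none (P? ∘ suc) n (λ y y<n → none (suc y) (s<s y<n))

count-complement : ∀ (P? : Decidable P) n → count P? n + count (¬? ∘ P?) n ≡ n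
count-complement P? zero = refl
count-complement P? (suc n) with P? 0
... | yes _ = cong suc (count-complement (P? ∘ suc) n)
... | no _ = trans (+-suc _ _) (cong suc (count-complement (P? ∘ suc) n))

count-periodic : ∀ (P? : Decidable P) m → (P ∘ (m +_)) ≐ P →
                 ∀ k → count P? (k * m) ≡ k * count P? m
count-periodic P? m periodic zero = refl
count-periodic P? m periodic (suc k) = begin
  count P? (m + k * m)                      ≡⟨ count-+ P? m (k * m) ⟩
  count P? m + count (P? ∘ (m +_)) (k * m)  ≡⟨ cong (count P? m +_) (shift (k * m)) ⟩
  count P? m + count P? (k * m)             ≡⟨ cong (count P? m +_) (count-periodic P? m periodic k) ⟩
  count P? m + k * count P? m               ∎
  where
  open ≡-Reasoning
  shift : ∀ l → count (P? ∘ (m +_)) l ≡ count P? l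
  shift = count-cong (P? ∘ (m +_)) P? periodic

count-∘suc : ∀ (P? : Decidable P) m → (P ∘ (m +_)) ≐ P → count (P? ∘ suc) m ≡ count P? m
count-∘suc P? m periodic = +-cancelˡ-≡ (count P? 1) _ _ (begin
  count P? 1 + count (P? ∘ suc) m     ≡⟨ cong (_+ count (P? ∘ suc) m) (+-identityʳ _) ⟩
  count P? (1 + m)                    ≡⟨ cong (count P?) (+-comm 1 m) ⟩
  count P? (m + 1)                    ≡⟨ count-+ P? m 1 ⟩
  count P? m + count (P? ∘ (m +_)) 1  ≡⟨ cong (count P? m +_) (count-cong (P? ∘ (m +_)) P? periodic 1) ⟩
  count P? m + count P? 1             ≡⟨ +-comm (count P? m) _ ⟩
  count P? 1 + count P? m             ∎)
  where open ≡-Reasoning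

count-multiples : ∀ {P : Pred ℕ ℓ} (P? : Decidable P) D .{{_ : NonZero D}} →
                  (∀ {y} → P y → D ∣ y) → ∀ k → count P? (k * D) ≡ count (P? ∘ (_* D)) k
count-multiples P? D multiples zero = refl
count-multiples {P = P} P? D@(suc d) multiples (suc k) = begin
  count P? (D + k * D)
    ≡⟨ count-+ P? D (k * D) ⟩
  indicator (P? 0) + count (P? ∘ suc) d + count (P? ∘ (D +_)) (k * D)
    ≡⟨ cong₂ (λ u v → indicator (P? 0) + u + v) none-inside
             (count-multiples (P? ∘ (D +_)) D shifted k) ⟩
  indicator (P? 0) + 0 + count (P? ∘ (_* D) ∘ suc) k
    ≡⟨ cong (_+ count (P? ∘ (_* D) ∘ suc) k) (+-identityʳ (indicator (P? 0))) ⟩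
  indicator (P? 0) + count (P? ∘ (_* D) ∘ suc) k
    ∎
  where
  open ≡-Reasoning
  none-inside : count (P? ∘ suc) d ≡ 0
  none-inside = count-none (P? ∘ suc) d (λ y y<d p → <⇒≱ (s<s y<d) (∣⇒≤ (multiples p)))
  shifted : ∀ {y} → P (D + y) → D ∣ y
  shifted p = ∣m+n∣m⇒∣n (multiples p) ∣-refl

length-filter-applyUpTo : ∀ (P? : Decidable P) f n →
                          length (filter P? (applyUpTo f n)) ≡ count (P? ∘ f) n
length-filter-applyUpTo P? f zero = refl
length-filter-applyUpTo P? f (suc n) with P? (f 0)
... | yes _ = cong suc (length-filter-applyUpTo P? (f ∘ suc) n)
... | no _ = length-filter-applyUpTo P? (f ∘ suc) n

length-filter-map : ∀ {a} {A : Set a} {P : Pred ℕ ℓ} (P? : Decidable P) (f : A → ℕ) xs →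
                    length (filter P? (map f xs)) ≡ length (filter (P? ∘ f) xs)
length-filter-map P? f [] = refl
length-filter-map P? f (x ∷ xs) with P? (f x)
... | yes _ = cong suc (length-filter-map P? f xs)
... | no _ = length-filter-map P? f xs

map-toℕ-allFin : ∀ n → map toℕ (allFin n) ≡ upTo n
map-toℕ-allFin n = trans (map-tabulate id toℕ) (tabulate-toℕ id n)
  where
  tabulate-toℕ : ∀ (f : ℕ → ℕ) n → tabulate {n = n} (f ∘ toℕ) ≡ applyUpTo f n
  tabulate-toℕ f zero = refl
  tabulate-toℕ f (suc n) = cong (f 0 ∷_) (tabulate-toℕ (f ∘ suc) n)

card-toℕ : ∀ (P? : Decidable P) n → card {n} (P ∘ toℕ) (P? ∘ toℕ) ≡ count P? n
card-toℕ P? n = begin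
  length (filter (P? ∘ toℕ) (allFin n))   ≡⟨ length-filter-map P? toℕ (allFin n) ⟨
  length (filter P? (map toℕ (allFin n))) ≡⟨ cong (length ∘ filter P?) (map-toℕ-allFin n) ⟩
  length (filter P? (upTo n))             ≡⟨ length-filter-applyUpTo P? id n ⟩
  count P? n                              ∎
  where open ≡-Reasoning

φ≡count : ∀ m → φ m ≡ count ((λ k → gcd k m ≟ℕ 1) ∘ suc) m
φ≡count m = trans (length-filter-map (λ k → gcd k m ≟ℕ 1) suc (upTo m))
                  (length-filter-applyUpTo _ id m)

-- φ counts over [1, m] rather than [0, m); periodicity makes the two ranges interchangeable.
count-non-coprime : ∀ (P? : Decidable P) m → (P ∘ (m +_)) ≐ P →
                    (λ k → gcd k m ≡ 1) ≐ ∁ P → count P? m ≡ m ∸ φ m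
count-non-coprime P? m periodic (cop⇒∁P , ∁P⇒cop) = begin
  count P? m
    ≡⟨ count-∘suc P? m periodic ⟨
  count (P? ∘ suc) m
    ≡⟨ m+n∸n≡m _ (count (¬? ∘ P? ∘ suc) m) ⟨
  count (P? ∘ suc) m + count (¬? ∘ P? ∘ suc) m ∸ count (¬? ∘ P? ∘ suc) m
    ≡⟨ cong₂ _∸_ (count-complement (P? ∘ suc) m)
                 (count-cong (¬? ∘ P? ∘ suc) _ (∁P⇒cop , cop⇒∁P) m) ⟩
  m ∸ count ((λ k → gcd k m ≟ℕ 1) ∘ suc) m
    ≡⟨ cong (m ∸_) (φ≡count m) ⟨
  m ∸ φ m
    ∎
  where open ≡-Reasoning

^-monoʳ-∣ : ∀ x {m n} → m ≤ n → x ^ m ∣ x ^ n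
^-monoʳ-∣ x {m} {n} m≤n = divides (x ^ (n ∸ m)) (begin
  x ^ n                 ≡⟨ cong (x ^_) (m+[n∸m]≡n m≤n) ⟨
  x ^ (m + (n ∸ m))     ≡⟨ ^-distribˡ-+-* x m (n ∸ m) ⟩
  x ^ m * x ^ (n ∸ m)   ≡⟨ *-comm (x ^ m) _ ⟩
  x ^ (n ∸ m) * x ^ m   ∎)
  where open ≡-Reasoning

prime∤1 : ∀ {q} → Prime q → ¬ q ∣ 1
prime∤1 q-prime q∣1 = ¬prime[1] (subst Prime (∣1⇒≡1 q∣1) q-prime)

∤⇒coprime : ∀ {q y} → Prime q → ¬ q ∣ y → Coprime y q
∤⇒coprime q-prime q∤y (d∣y , d∣q) with prime⇒irreducible q-prime d∣q
... | inj₁ d≡1 = d≡1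
... | inj₂ refl = contradiction d∣y q∤y

coprime-* : ∀ {y m k} → Coprime y m → Coprime y k → Coprime y (m * k)
coprime-* c₁ c₂ (d∣y , d∣mk) =
  c₂ (d∣y , coprime-divisor (λ (e∣d , e∣m) → c₁ (∣-trans e∣d d∣y , e∣m)) d∣mk)

//≡/ : ∀ m n .{{_ : NonZero n}} → m // n ≡ m / n
//≡/ m (suc n) = refl

n∣[n/d]*_≐d∣_ : ∀ {n d} .{{_ : NonZero n}} .{{_ : NonZero d}} → d ∣ n →
                (λ y → n ∣ (n // d) * y) ≐ (d ∣_)
n∣[n/d]*_≐d∣_ {n} {d} d∣n = *-cancelˡ-∣ c ∘ subst₂ _∣_ n≡c*d (cong (_* _) n/d≡c)
                         , subst₂ _∣_ (sym n≡c*d) (cong (_* _) (sym n/d≡c)) ∘ *-monoʳ-∣ c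
  where
  c : ℕ
  c = quotient d∣n
  instance
    c≢0 : NonZero c
    c≢0 = quotient≢0 d∣n
  n≡c*d : n ≡ c * d
  n≡c*d = _∣_.equality d∣n
  n/d≡c : n // d ≡ c
  n/d≡c = trans (//≡/ n d) (n/m≡quotient d∣n)

∏-suc : ∀ (f : Fin (suc r) → ℕ) → ∏ f ≡ f zero * ∏ (f ∘ suc)
∏-suc f = cong (λ xs → f zero * product xs)
                (trans (map-tabulate suc f) (sym (map-tabulate id (f ∘ suc))))

∏-nonZero : ∀ (f : Fin r → ℕ) → (∀ i → NonZero (f i)) → NonZero (∏ f)
∏-nonZero {zero} f _ = _
∏-nonZero {suc r} f nz =
  subst NonZero (sym (∏-suc f))
    (m*n≢0 (f zero) (∏ (f ∘ suc)) {{nz zero}} {{∏-nonZero (f ∘ suc) (nz ∘ suc)}})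

∏-mono-∣ : ∀ {f g : Fin r → ℕ} → (∀ i → f i ∣ g i) → ∏ f ∣ ∏ g
∏-mono-∣ {zero} _ = ∣-refl
∏-mono-∣ {suc r} {f} {g} f∣g =
  subst₂ _∣_ (sym (∏-suc f)) (sym (∏-suc g)) (*-pres-∣ (f∣g zero) (∏-mono-∣ (f∣g ∘ suc)))

coprime-∏ : ∀ {y} (f : Fin r → ℕ) → (∀ i → Coprime y (f i)) → Coprime y (∏ f)
coprime-∏ {zero} f _ (_ , d∣1) = ∣1⇒≡1 d∣1
coprime-∏ {suc r} f cop =
  subst (Coprime _) (sym (∏-suc f)) (coprime-* (cop zero) (coprime-∏ (f ∘ suc) (cop ∘ suc)))

omit : (Fin r → ℕ) → Fin r → Fin r → ℕ
omit f i = updateAt f i (const 1)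

omit-self : ∀ (f : Fin r → ℕ) i → omit f i i ≡ 1
omit-self f i = updateAt-updates i f

omit-other : ∀ (f : Fin r → ℕ) {i j} → i ≢ j → omit f j i ≡ f i
omit-other f {i} {j} = updateAt-minimal i j f

omit-mono-∣ : ∀ {f g : Fin r → ℕ} → (∀ i → f i ∣ g i) →
              ∀ j i → omit f j i ∣ omit g j i
omit-mono-∣ {f = f} {g} f∣g j i with i ≟ j
... | yes refl = subst₂ _∣_ (sym (omit-self f i)) (sym (omit-self g i)) ∣-refl
... | no i≢j = subst₂ _∣_ (sym (omit-other f i≢j)) (sym (omit-other g i≢j)) (f∣g i)

∏-omit : ∀ (f : Fin r → ℕ) i → ∏ f ≡ f i * ∏ (omit f i)
∏-omit {suc r} f zero = begin
  ∏ f                            ≡⟨ ∏-suc f ⟩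
  f zero * ∏ (f ∘ suc)           ≡⟨ cong (f zero *_) (*-identityˡ _) ⟨
  f zero * (1 * ∏ (f ∘ suc))     ≡⟨ cong (f zero *_) (∏-suc (omit f zero)) ⟨
  f zero * ∏ (omit f zero)       ∎
  where open ≡-Reasoning
∏-omit {suc r} f (suc i) = begin
  ∏ f                                          ≡⟨ ∏-suc f ⟩
  f zero * ∏ (f ∘ suc)                         ≡⟨ cong (f zero *_) (∏-omit (f ∘ suc) i) ⟩
  f zero * (f (suc i) * ∏ (omit (f ∘ suc) i))  ≡⟨ x∙yz≈y∙xz (f zero) (f (suc i)) _ ⟩
  f (suc i) * (f zero * ∏ (omit (f ∘ suc) i))  ≡⟨ cong (f (suc i) *_) (∏-suc (omit f (suc i))) ⟨
  f (suc i) * ∏ (omit f (suc i))               ∎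
  where open ≡-Reasoning

∏-omit₂ : ∀ (f : Fin r → ℕ) {a b} → b ≢ a → ∏ f ≡ f a * (f b * ∏ (omit (omit f a) b))
∏-omit₂ {r = r} f {a} {b} b≢a = begin
  ∏ f                                 ≡⟨ ∏-omit f a ⟩
  f a * ∏ f′                          ≡⟨ cong (f a *_) (∏-omit f′ b) ⟩
  f a * (omit f a b * ∏ (omit f′ b))  ≡⟨ cong (λ x → f a * (x * ∏ (omit f′ b))) (omit-other f b≢a) ⟩
  f a * (f b * ∏ (omit f′ b))         ∎
  where
  open ≡-Reasoning
  f′ : Fin r → ℕ
  f′ = omit f a

∣-∏ : ∀ (f : Fin r → ℕ) i → f i ∣ ∏ f
∣-∏ f i = divides (∏ (omit f i)) (trans (∏-omit f i) (*-comm (f i) _))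

UnionBesides : (a b : Fin r) → (Fin r → Pred ℕ ℓ) → Pred ℕ ℓ
UnionBesides a b X y = ∃[ i ] (¬ i ≡ a × ¬ i ≡ b × X i y)

unionBesides? : ∀ (a b : Fin r) {X : Fin r → Pred ℕ ℓ} → (∀ i → Decidable (X i)) →
                Decidable (UnionBesides a b X)
unionBesides? a b X? y = any? (λ i → ¬? (i ≟ a) ×-dec (¬? (i ≟ b) ×-dec X? i y))

UnionBesides-cong : ∀ {a b : Fin r} {X : Fin r → Pred ℕ ℓ} {Y : Fin r → Pred ℕ ℓ′} →
                    (∀ i → ¬ i ≡ a → ¬ i ≡ b → X i ≐ Y i) →
                    UnionBesides a b X ≐ UnionBesides a b Y
UnionBesides-cong X≐Y =
    (λ (i , i≢a , i≢b , x) → i , i≢a , i≢b , proj₁ (X≐Y i i≢a i≢b) x)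
  , (λ (i , i≢a , i≢b , y) → i , i≢a , i≢b , proj₂ (X≐Y i i≢a i≢b) y)

module UnionOfSubgroups {r} (p e : Fin r → ℕ) (p-prime : ∀ i → Prime (p i))
                        (e≥1 : ∀ i → 1 ≤ e i) (a b : Fin r) (b≢a : b ≢ a)
                        (s : ℕ) (s≤eₐ : s ≤ e a) where

  n D M : ℕ
  n = nOf p e
  D = p a ^ s
  M = ∏ (omit (omit p a) b)

  instance
    p≢0 : ∀ {i} → NonZero (p i)
    p≢0 {i} = prime⇒nonZero (p-prime i)
    D≢0 : NonZero D
    D≢0 = m^n≢0 (p a) s
    n≢0 : NonZero n
    n≢0 = ∏-nonZero _ (λ i → m^n≢0 (p i) (e i))
    pₐp_b≢0 : NonZero (p a * p b)
    pₐp_b≢0 = m*n≢0 (p a) (p b)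

  omit-omit-other : ∀ (f : Fin r → ℕ) {i} → ¬ i ≡ a → ¬ i ≡ b → omit (omit f a) b i ≡ f i
  omit-omit-other f i≢a i≢b = trans (omit-other (omit f a) i≢b) (omit-other f i≢a)

  p∣M : ∀ i → ¬ i ≡ a → ¬ i ≡ b → p i ∣ M
  p∣M i i≢a i≢b = subst (_∣ M) (omit-omit-other p i≢a i≢b) (∣-∏ _ i)

  ∏p≡pₐ*p_b*M : ∏ p ≡ p a * (p b * M)
  ∏p≡pₐ*p_b*M = ∏-omit₂ p b≢a

  ∏p//pₐp_b≡M : ∏ p // (p a * p b) ≡ M
  ∏p//pₐp_b≡M = begin
    ∏ p // (p a * p b)             ≡⟨ //≡/ (∏ p) (p a * p b) ⟩
    ∏ p / (p a * p b)              ≡⟨ cong (_/ (p a * p b)) ∏p≡M*pₐp_b ⟩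
    M * (p a * p b) / (p a * p b)  ≡⟨ m*n/n≡m M (p a * p b) ⟩
    M                              ∎
    where
    open ≡-Reasoning
    ∏p≡M*pₐp_b : ∏ p ≡ M * (p a * p b)
    ∏p≡M*pₐp_b = trans ∏p≡pₐ*p_b*M (x∙yz≈z∙xy (p a) (p b) M)

  M*D∣n : M * D ∣ n
  M*D∣n = subst₂ _∣_ (*-comm D M) (sym (∏-omit₂ pᵉ b≢a))
            (*-pres-∣ (^-monoʳ-∣ (p a) s≤eₐ) (∣n⇒∣m*n (p b ^ e b) M∣rest))
    where
    pᵉ : Fin r → ℕ
    pᵉ i = p i ^ e i
    p∣pᵉ : ∀ i → p i ∣ pᵉ i
    p∣pᵉ i = subst (_∣ pᵉ i) (*-identityʳ (p i)) (^-monoʳ-∣ (p i) (e≥1 i))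
    M∣rest : M ∣ ∏ (omit (omit pᵉ a) b)
    M∣rest = ∏-mono-∣ (omit-mono-∣ (omit-mono-∣ p∣pᵉ a) b)

  T : ℕ
  T = quotient M*D∣n

  n≡T*M*D : n ≡ T * M * D
  n≡T*M*D = trans (_∣_.equality M*D∣n) (sym (*-assoc T M D))

  HasOtherPrimeFactor : Pred ℕ _
  HasOtherPrimeFactor = UnionBesides a b (λ i → p i ∣_)

  hasOtherPrimeFactor? : Decidable HasOtherPrimeFactor
  hasOtherPrimeFactor? = unionBesides? a b (λ i → p i ∣?_)

  HasOtherPrimeFactor-periodic : (HasOtherPrimeFactor ∘ (M +_)) ≐ HasOtherPrimeFactor
  HasOtherPrimeFactor-periodic = UnionBesides-cong λ i i≢a i≢b →
    (λ p∣M+y → ∣m+n∣m⇒∣n p∣M+y (p∣M i i≢a i≢b)) , ∣m∣n⇒∣m+n (p∣M i i≢a i≢b)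

  coprime≐∁HasOtherPrimeFactor : (λ k → gcd k M ≡ 1) ≐ ∁ HasOtherPrimeFactor
  coprime≐∁HasOtherPrimeFactor = coprime⇒∁ , ∁⇒coprime
    where
    coprime⇒∁ : ∀ {k} → gcd k M ≡ 1 → ¬ HasOtherPrimeFactor k
    coprime⇒∁ gcd≡1 (i , i≢a , i≢b , p∣k) =
      prime∤1 (p-prime i) (subst (p i ∣_) gcd≡1 (gcd-greatest p∣k (p∣M i i≢a i≢b)))
    ∁⇒coprime : ∀ {k} → ¬ HasOtherPrimeFactor k → gcd k M ≡ 1
    ∁⇒coprime {k} none = coprime⇒gcd≡1 (coprime-∏ _ coprime-factor)
      where
      coprime-1 : Coprime k 1
      coprime-1 (_ , d∣1) = ∣1⇒≡1 d∣1
      coprime-factor : ∀ i → Coprime k (omit (omit p a) b i)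
      coprime-factor i with i ≟ b | i ≟ a
      ... | yes refl | _ = subst (Coprime k) (sym (omit-self (omit p a) i)) coprime-1
      ... | no i≢b | yes refl =
        subst (Coprime k) (sym (trans (omit-other (omit p a) i≢b) (omit-self p i))) coprime-1
      ... | no i≢b | no i≢a = subst (Coprime k) (sym (omit-omit-other p i≢a i≢b))
        (∤⇒coprime (p-prime i) (λ p∣k → none (i , i≢a , i≢b , p∣k)))

  MultipleOfOther : Pred ℕ _
  MultipleOfOther = UnionBesides a b (λ i → p i * D ∣_)

  multipleOfOther? : Decidable MultipleOfOther
  multipleOfOther? = unionBesides? a b (λ i → p i * D ∣?_)

  -- Q p e a b s and Q? p e a b s are definitionally InSubgroup ∘ toℕ and inSubgroup? ∘ toℕ.
  InSubgroup : Pred ℕ _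
  InSubgroup = UnionBesides a b (λ i y → n ∣ (n // (p i * D)) * y)

  inSubgroup? : Decidable InSubgroup
  inSubgroup? = unionBesides? a b (λ i y → n ∣? (n // (p i * D)) * y)

  InSubgroup≐MultipleOfOther : InSubgroup ≐ MultipleOfOther
  InSubgroup≐MultipleOfOther = UnionBesides-cong λ i i≢a i≢b →
    n∣[n/d]*_≐d∣_ {{n≢0}} {{m*n≢0 (p i) D}}
      (∣-trans (*-monoˡ-∣ D (p∣M i i≢a i≢b)) M*D∣n)

  MultipleOfOther⇒D∣ : ∀ {y} → MultipleOfOther y → D ∣ y
  MultipleOfOther⇒D∣ (i , _ , _ , pD∣y) = ∣-trans (n∣m*n (p i)) pD∣y

  MultipleOfOther-cancel : (MultipleOfOther ∘ (_* D)) ≐ HasOtherPrimeFactor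
  MultipleOfOther-cancel = UnionBesides-cong λ i _ _ → *-cancelʳ-∣ D , *-monoˡ-∣ D

  card-Q : card (Q p e a b s) (Q? p e a b s) ≡ T * (M ∸ φ M)
  card-Q = begin
    card (Q p e a b s) (Q? p e a b s)
      ≡⟨ card-toℕ inSubgroup? n ⟩
    count inSubgroup? n
      ≡⟨ count-cong inSubgroup? multipleOfOther? InSubgroup≐MultipleOfOther n ⟩
    count multipleOfOther? n
      ≡⟨ cong (count multipleOfOther?) n≡T*M*D ⟩
    count multipleOfOther? (T * M * D)
      ≡⟨ count-multiples multipleOfOther? D MultipleOfOther⇒D∣ (T * M) ⟩
    count (multipleOfOther? ∘ (_* D)) (T * M)
      ≡⟨ count-cong _ hasOtherPrimeFactor? MultipleOfOther-cancel (T * M) ⟩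
    count hasOtherPrimeFactor? (T * M)
      ≡⟨ count-periodic hasOtherPrimeFactor? M HasOtherPrimeFactor-periodic T ⟩
    T * count hasOtherPrimeFactor? M
      ≡⟨ cong (T *_) (count-non-coprime hasOtherPrimeFactor? M
                        HasOtherPrimeFactor-periodic coprime≐∁HasOtherPrimeFactor) ⟩
    T * (M ∸ φ M)
      ∎
    where open ≡-Reasoning

lemma2p6 : (r : ℕ) (p e : Fin r → ℕ)
    → (∀ i → Prime (p i))
    → (∀ i j → i F.< j → p i < p j)
    → (∀ i → 1 ≤ e i)
    → (a b : Fin r) → ¬ (a ≡ b)
    → (s : ℕ) → 1 ≤ s → s ≤ e a
    → card (Q p e a b s) (Q? p e a b s) * p a ^ (s ∸ 1) * ∏ p
      ≡ nOf p e * p b * ((∏ p // (p a * p b)) ∸ φ (∏ p // (p a * p b)))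
lemma2p6 r p e p-prime _ e≥1 a b a≢b (suc s) _ s<eₐ = begin
  card (Q p e a b (suc s)) (Q? p e a b (suc s)) * p a ^ s * ∏ p
    ≡⟨ cong₂ (λ c P → c * p a ^ s * P) card-Q ∏p≡pₐ*p_b*M ⟩
  T * (M ∸ φ M) * p a ^ s * (p a * (p b * M))
    ≡⟨ rearrange T (M ∸ φ M) (p a ^ s) (p a) (p b) M ⟩
  T * M * (p a * p a ^ s) * p b * (M ∸ φ M)
    ≡⟨ cong (λ m → m * p b * (M ∸ φ M)) n≡T*M*D ⟨
  nOf p e * p b * (M ∸ φ M)
    ≡⟨ cong (λ m → nOf p e * p b * (m ∸ φ m)) ∏p//pₐp_b≡M ⟨
  nOf p e * p b * ((∏ p // (p a * p b)) ∸ φ (∏ p // (p a * p b)))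
    ∎
  where
  open ≡-Reasoning
  open UnionOfSubgroups p e p-prime e≥1 a b (a≢b ∘ sym) (suc s) s<eₐ
  rearrange : ∀ t c x pₐ p_b m → t * c * x * (pₐ * (p_b * m)) ≡ t * m * (pₐ * x) * p_b * c
  rearrange = solve-∀
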